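{- Let $p,q$ be positive integers with $p\ge q$. For every $\epsilon>0$ there exists an integer $n_0$ such that for every $n\ge n_0$, $$a(p,q;K_{1,n})\ \ge\ a^*(p,q;K_{1,n})\ \ge\ \left(1+\frac{q}{2p}-\epsilon\right)n,$$ where $K_{1,n}$ is the star with $n$ edges.
   Context: Let $p\ge q\ge 1$ be integers and $G$ a finite graph without isolated vertices. In both games below, played on the edges of the complete graph $K_N$ (all initially uncolored), each round consists of Alice first coloring $p$ uncolored edges blue and then Bob coloring $q$ uncolored edges red. In the $(p,q)$-achievement game, the player who first completes a copy of $G$ entirely in his or her own color wins (otherwise a draw); $a(p,q;G)$ is the smallest $N$ for which Alice has a winning strategy in it on $K_N$. In the first player game (a Maker/Breaker game), Alice wins if at some point the blue edges contain a copy of $G$, and Bob wins otherwise; $a^*(p,q;G)$ is the smallest $N$ for which Alice has a winning strategy in it on $K_N$. -}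

module Defs where

open import Data.Nat using (ℕ; zero; suc; _*_; _<_)
open import Data.Fin using (Fin; toℕ)
open import Data.Fin.Base using () renaming (zero to fzero)
open import Data.Product using (Σ; _×_; _,_; proj₁; proj₂; ∃-syntax)
open import Data.Sum using (_⊎_)
import Data.Empty
open import Data.List using (List; []; _++_; length)
open import Data.List.Relation.Unary.All using (All)
open import Data.List.Relation.Unary.Any using (Any)
open import Data.List.Relation.Unary.Unique.Propositional using (Unique)
open import Data.List.Membership.Propositional using (_∈_; _∉_)
open import Data.Integer using (+_)
open import Data.Rational using (ℚ; 0ℚ; _/_)
open import Relation.Binary.PropositionalEquality using (_≡_; _≢_)
open import Function.Definitions using (Injective)

record Graph : Set₁ where
  field
    v   : ℕ
    Adj : Fin v → Fin v → Set

open Graph public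

Star : ℕ → Graph
Star n = record
  { v   = suc n
  ; Adj = λ x y → (x ≡ fzero × y ≢ fzero) ⊎ (y ≡ fzero × x ≢ fzero)
  }

-- Edges of K_N: pairs (i , j) of vertices with i < j (an unordered pair
-- {i,j}, i ≠ j, in canonical form).

Edge : ℕ → Set
Edge N = Σ (Fin N × Fin N) (λ ij → toℕ (proj₁ ij) < toℕ (proj₂ ij))

Joins : ∀ {N} → Edge N → Fin N → Fin N → Set
Joins ((i , j) , _) x y = (i ≡ x × j ≡ y) ⊎ (i ≡ y × j ≡ x)

EdgeIn : ∀ {N} → List (Edge N) → Fin N → Fin N → Set
EdgeIn S x y = Any (λ e → Joins e x y) S

ContainsCopy : (G : Graph) → ∀ {N} → List (Edge N) → Set
ContainsCopy G {N} S =
  Σ (Fin (v G) → Fin N) λ f →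
    Injective _≡_ _≡_ f × (∀ x y → Adj G x y → EdgeIn S (f x) (f y))

-- Game states: B = blue edges, R = red edges; an edge is free if uncoloured.

Free : ∀ {N} → List (Edge N) → List (Edge N) → Edge N → Set
Free B R e = e ∉ B × e ∉ R

ValidMove : ∀ {N} → ℕ → List (Edge N) → List (Edge N) → List (Edge N) → Set
ValidMove k B R L =
  Unique L × All (Free B R) L ×
  (length L ≡ k ⊎ (length L < k × (∀ e → Free B R e → e ∈ L)))

-- "Alice (to move) can force a win from state (B , R)".  Inductive, hence
-- the win is reached after finitely many rounds; since the board is finite
-- this is exactly the existence of a winning strategy.

data MBWin (p q : ℕ) (G : Graph) (N : ℕ) : List (Edge N) → List (Edge N) → Set where
  move : ∀ {B R} (L : List (Edge N)) → ValidMove p B R L →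
         ContainsCopy G (L ++ B)
         ⊎ (∀ (M : List (Edge N)) → ValidMove q (L ++ B) R M → MBWin p q G N (L ++ B) (M ++ R))
         → MBWin p q G N B R

data AchWin (p q : ℕ) (G : Graph) (N : ℕ) : List (Edge N) → List (Edge N) → Set where
  move : ∀ {B R} (L : List (Edge N)) → ValidMove p B R L →
         ContainsCopy G (L ++ B)
         ⊎ (∀ (M : List (Edge N)) → ValidMove q (L ++ B) R M →
              (ContainsCopy G (M ++ R) → Data.Empty.⊥) × AchWin p q G N (L ++ B) (M ++ R))
         → AchWin p q G N B R

AliceWinsMB : ℕ → ℕ → Graph → ℕ → Set
AliceWinsMB p q G N = MBWin p q G N [] []

AliceWinsAch : ℕ → ℕ → Graph → ℕ → Set
AliceWinsAch p q G N = AchWin p q G N [] []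

-- the rational number q / (2p)  (only used with p ≥ 1; value at p = 0 irrelevant)
q/2p : ℕ → ℕ → ℚ
q/2p q zero    = 0ℚ
q/2p q (suc p) = + q / (2 * suc p)

-- An Alice win in the achievement game is in particular a win in the Maker–Breaker game, so it suffices to give Bob a
-- strategy there. Call the danger of a vertex v the truncated difference q·deg_blue(v) − 2p·deg_red(v), counted only
-- while v still has an uncoloured edge. Bob colours q uncoloured edges at a vertex of maximal danger, lowering it by
-- k = 2pq (or killing the vertex), while Alice's p edges raise the total danger by at most k. For the potentials
-- Φ_t = Σ_v (danger(v) − t)⁺ at the thresholds t = 2kj this gives, by induction over the rounds, Φ_{2kj} ≤ kN/2^j + 2k:
-- either the maximal danger is large and Bob pays back Alice's gain, or it is small and Φ_{2k(j+1)} ≤ (Φ_{2kj} + k)/2.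
-- Once 2^J > kN no danger exceeds T = 2kJ + 3k. A blue star with centre c then has n ≤ deg_blue(c) ≤ N − 1 − deg_red(c),
-- whence (2p + q)n ≤ 2pN + T; choosing J of order n/A with A large makes T an arbitrarily small multiple of n.

module Submission where

open import Defs
open import Data.Nat.Base as ℕ
  using (ℕ; zero; suc; _+_; _*_; _∸_; _^_; _≤_; _<_; z≤n; s≤s; NonZero)
open import Data.Nat.Properties
open import Algebra.Properties.Semiring.Sum +-*-semiring
  using (sum; sum-cong-≗; sum-remove; sum-replicate-zero; *-distribˡ-sum)
open import Data.Fin.Base using (Fin; toℕ; punchIn) renaming (zero to fzero; suc to fsuc)
open import Data.Fin.Properties using (toℕ-injective; punchInᵢ≢i; any?)
  renaming (_≟_ to _≟ᶠ_; suc-injective to fsuc-injective)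
open import Data.Product using (Σ; ∃; ∃-syntax; _×_; _,_; proj₁; proj₂)
open import Data.Sum using (_⊎_; inj₁; inj₂)
open import Data.Empty using (⊥-elim)
open import Data.List.Base
  using (List; []; _∷_; _++_; length; map; filter; take; tabulate; deduplicate; cartesianProduct; allFin)
import Data.List.Properties as List
open import Data.List.Relation.Unary.Any as Any using (here; there)
import Data.List.Relation.Unary.Any.Properties as Any
open import Data.List.Relation.Unary.All as All using (All; []; _∷_)
import Data.List.Relation.Unary.All.Properties as All
open import Data.List.Relation.Unary.AllPairs using ([]; _∷_)
open import Data.List.Relation.Unary.Unique.Propositional using (Unique)
import Data.List.Relation.Unary.Unique.Propositional.Properties as Unique
import Data.List.Relation.Unary.Unique.DecPropositional.Properties as Unique
open import Data.List.Membership.Propositional using (_∈_; find; lose)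
import Data.List.Membership.Propositional.Properties as ∈
import Data.List.Membership.DecPropositional as DecMembership
open import Relation.Binary.PropositionalEquality using (_≡_; _≢_; refl; sym; trans; cong; cong₂; subst; subst₂; module ≡-Reasoning)
open import Data.Nat.Tactic.RingSolver using (solve-∀)
open import Data.Nat.DivMod using (m%n<n; m≡m%n+[m/n]*n; m/n*n≤m)
open import Relation.Binary.Definitions using (DecidableEquality; tri<; tri≈; tri>)
open import Relation.Nullary using (Dec; yes; no; ¬_; contradiction)
open import Relation.Nullary.Decidable using (_×-dec_; _⊎-dec_; ¬?)
open import Relation.Unary using (Pred; Decidable; ∅)
open import Relation.Unary.Properties using (∅?)
open import Data.List.Relation.Binary.Disjoint.Propositional using (Disjoint)
open import Function.Base using (_∘_; const)
open import Data.Integer.Base as ℤ using (+[1+_])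
import Data.Integer.Properties as ℤₚ
import Data.Integer.Tactic.RingSolver as ℤ-Solver
open import Data.Nat.Coprimality using (Coprime)
open import Data.Rational.Base as ℚ using (ℚ; mkℚ; 1ℚ; toℚᵘ; Positive)
import Data.Rational.Properties as ℚₚ
open import Data.Rational.Unnormalised.Base as ℚᵘ using (mkℚᵘ; *≤*)
import Data.Rational.Unnormalised.Properties as ℚᵘₚ
open import Algebra.Properties.CommutativeSemigroup +-commutativeSemigroup using (interchange)

_≟ₑ_ : ∀ {N} → DecidableEquality (Edge N)
((i , j) , i<j) ≟ₑ ((i′ , j′) , i′<j′) with i ≟ᶠ i′ | j ≟ᶠ j′
... | yes refl | yes refl = yes (cong ((i , j) ,_) (<-irrelevant i<j i′<j′))
... | no i≢i′  | _        = no λ { refl → i≢i′ refl }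
... | yes _    | no j≢j′  = no λ { refl → j≢j′ refl }

joins? : ∀ {N} (e : Edge N) x y → Dec (Joins e x y)
joins? ((i , j) , _) x y = ((i ≟ᶠ x) ×-dec (j ≟ᶠ y)) ⊎-dec ((i ≟ᶠ y) ×-dec (j ≟ᶠ x))

edgeIn? : ∀ {N} (S : List (Edge N)) x y → Dec (EdgeIn S x y)
edgeIn? S x y = Any.any? (λ e → joins? e x y) S

joins⇒≢ : ∀ {N} (e : Edge N) {x y} → Joins e x y → x ≢ y
joins⇒≢ (_ , i<j) (inj₁ (refl , refl)) refl = <-irrefl refl i<j
joins⇒≢ (_ , i<j) (inj₂ (refl , refl)) refl = <-irrefl refl i<j

joins-injective : ∀ {N} (e e′ : Edge N) {x y} → Joins e x y → Joins e′ x y → e ≡ e′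
joins-injective ((i , j) , i<j) (_ , i<j′) (inj₁ (refl , refl)) (inj₁ (refl , refl)) =
  cong ((i , j) ,_) (<-irrelevant i<j i<j′)
joins-injective ((i , j) , i<j) (_ , i<j′) (inj₂ (refl , refl)) (inj₂ (refl , refl)) =
  cong ((i , j) ,_) (<-irrelevant i<j i<j′)
joins-injective (_ , i<j) (_ , j<i) (inj₁ (refl , refl)) (inj₂ (refl , refl)) = ⊥-elim (<-asym i<j j<i)
joins-injective (_ , i<j) (_ , j<i) (inj₂ (refl , refl)) (inj₁ (refl , refl)) = ⊥-elim (<-asym i<j j<i)

edgeBetween : ∀ {N} {x y : Fin N} → x ≢ y → Σ (Edge N) λ e → Joins e x y
edgeBetween {x = x} {y} x≢y with <-cmp (toℕ x) (toℕ y)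
... | tri< x<y _ _ = ((x , y) , x<y) , inj₁ (refl , refl)
... | tri≈ _ x≡y _ = ⊥-elim (x≢y (toℕ-injective x≡y))
... | tri> _ _ y<x = ((y , x) , y<x) , inj₂ (refl , refl)

joins-∈ : ∀ {N} {S : List (Edge N)} {e x y} → Joins e x y → EdgeIn S x y → e ∈ S
joins-∈ {e = e} e~ xy∈S = let e′ , e′∈S , e′~ = find xy∈S in subst (_∈ _) (joins-injective e′ e e′~ e~) e′∈S

IncidentTo : ∀ {N} → Fin N → Edge N → Set
IncidentTo v ((i , j) , _) = i ≡ v ⊎ j ≡ v

incidentTo? : ∀ {N} (v : Fin N) (e : Edge N) → Dec (IncidentTo v e)
incidentTo? v ((i , j) , _) = (i ≟ᶠ v) ⊎-dec (j ≟ᶠ v)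

otherEnd : ∀ {N} → Fin N → Edge N → Fin N
otherEnd v ((i , j) , _) with i ≟ᶠ v
... | yes _ = j
... | no _  = i

joins-otherEnd : ∀ {N} {v : Fin N} e → IncidentTo v e → Joins e v (otherEnd v e)
joins-otherEnd {v = v} ((i , j) , _) v∈e with i ≟ᶠ v | v∈e
... | yes refl | _         = inj₁ (refl , refl)
... | no i≢v   | inj₁ i≡v  = ⊥-elim (i≢v i≡v)
... | no _     | inj₂ refl = inj₂ (refl , refl)

joins⇒incidentTo : ∀ {N} (e : Edge N) {v u} → Joins e v u → IncidentTo v e
joins⇒incidentTo _ (inj₁ (refl , refl)) = inj₁ refl
joins⇒incidentTo _ (inj₂ (refl , refl)) = inj₂ refl

joins⇒otherEnd : ∀ {N} (e : Edge N) {v u} → Joins e v u → otherEnd v e ≡ u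
joins⇒otherEnd ((i , _) , _) (inj₁ (refl , refl)) with i ≟ᶠ i
... | yes _   = refl
... | no i≢i  = ⊥-elim (i≢i refl)
joins⇒otherEnd ((i , j) , i<j) (inj₂ (refl , refl)) with i ≟ᶠ j
... | yes refl = ⊥-elim (<-irrefl refl i<j)
... | no _     = refl

otherEnd-injective : ∀ {N} {v : Fin N} e e′ → IncidentTo v e → IncidentTo v e′ →
                     otherEnd v e ≡ otherEnd v e′ → e ≡ e′
otherEnd-injective e e′ v∈e v∈e′ same =
  joins-injective e e′ (joins-otherEnd e v∈e) (subst (Joins e′ _) (sym same) (joins-otherEnd e′ v∈e′))

otherEnds-unique : ∀ {N} {v : Fin N} {es} → Unique es → All (IncidentTo v) es → Unique (map (otherEnd v) es)
otherEnds-unique {es = []} [] [] = []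
otherEnds-unique {v = v} {e ∷ es} (e∉es ∷ !es) (v∈e ∷ v∈es) = distinct e∉es v∈es ∷ otherEnds-unique !es v∈es
  where
    distinct : ∀ {fs} → All (e ≢_) fs → All (IncidentTo v) fs → All (otherEnd v e ≢_) (map (otherEnd v) fs)
    distinct [] [] = []
    distinct (e≢f ∷ e≢fs) (v∈f ∷ v∈fs) =
      (e≢f ∘ otherEnd-injective e _ v∈e v∈f) ∷ distinct e≢fs v∈fs

edgesAmong : ∀ {N} → List (Fin N × Fin N) → List (Edge N)
edgesAmong [] = []
edgesAmong ((i , j) ∷ ijs) with toℕ i <? toℕ j
... | yes i<j = ((i , j) , i<j) ∷ edgesAmong ijs
... | no  _   = edgesAmong ijs

∈-edgesAmong : ∀ {N} {ijs : List (Fin N × Fin N)} (e : Edge N) → proj₁ e ∈ ijs → e ∈ edgesAmong ijs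
∈-edgesAmong {ijs = (i , j) ∷ _} (_ , i<j) (here refl) with toℕ i <? toℕ j
... | yes i<j′ = here (cong ((i , j) ,_) (<-irrelevant i<j i<j′))
... | no  i≮j  = contradiction i<j i≮j
∈-edgesAmong {ijs = (i , j) ∷ _} e (there ij∈) with toℕ i <? toℕ j
... | yes _ = there (∈-edgesAmong e ij∈)
... | no  _ = ∈-edgesAmong e ij∈

allEdges : ∀ N → List (Edge N)
allEdges N = edgesAmong (cartesianProduct (allFin N) (allFin N))

∈-allEdges : ∀ {N} (e : Edge N) → e ∈ allEdges N
∈-allEdges ((i , j) , i<j) = ∈-edgesAmong _ (∈.∈-cartesianProduct⁺ (∈.∈-allFin i) (∈.∈-allFin j))

sum-mono-≤ : ∀ {n} {f g : Fin n → ℕ} → (∀ i → f i ≤ g i) → sum f ≤ sum g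
sum-mono-≤ {zero}  f≤g = z≤n
sum-mono-≤ {suc n} f≤g = +-mono-≤ (f≤g fzero) (sum-mono-≤ (f≤g ∘ fsuc))

sum-+ : ∀ {n} (f g : Fin n → ℕ) → sum (λ i → f i + g i) ≡ sum f + sum g
sum-+ {zero}  f g = refl
sum-+ {suc n} f g = trans (cong (f fzero + g fzero +_) (sum-+ (f ∘ fsuc) (g ∘ fsuc)))
                           (interchange (f fzero) (g fzero) (sum (f ∘ fsuc)) (sum (g ∘ fsuc)))

sum-≤-* : ∀ {n} {f : Fin n → ℕ} c → (∀ i → f i ≤ c) → sum f ≤ n * c
sum-≤-* {zero}  c f≤c = z≤n
sum-≤-* {suc n} c f≤c = +-mono-≤ (f≤c fzero) (sum-≤-* c (f≤c ∘ fsuc))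

≤-sum : ∀ {n} (f : Fin n → ℕ) i → f i ≤ sum f
≤-sum {suc n} f i = subst (f i ≤_) (sym (sum-remove {i = i} f)) (m≤m+n (f i) _)

argmax : ∀ {n} (f : Fin (suc n) → ℕ) → ∃[ m ] (∀ i → f i ≤ f m)
argmax {zero}  f = fzero , λ { fzero → ≤-refl }
argmax {suc n} f with argmax (f ∘ fsuc)
... | m , f∘fsuc≤fm with f fzero ≤? f (fsuc m)
...   | yes f0≤fm = fsuc m , λ { fzero → f0≤fm ; (fsuc i) → f∘fsuc≤fm i }
...   | no  f0≰fm = fzero , λ { fzero → ≤-refl ; (fsuc i) → ≤-trans (f∘fsuc≤fm i) (<⇒≤ (≰⇒> f0≰fm)) }

sum-+-≤ : ∀ {n} {f g : Fin n → ℕ} {k} → (∀ i → f i ≤ g i) → ∀ v → f v + k ≤ g v → sum f + k ≤ sum g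
sum-+-≤ {suc n} {f} {g} {k} f≤g v fv+k≤gv = begin
  sum f + k                         ≡⟨ cong (_+ k) (sum-remove {i = v} f) ⟩
  f v + sum (f ∘ punchIn v) + k      ≡⟨ +-assoc (f v) _ k ⟩
  f v + (sum (f ∘ punchIn v) + k)    ≡⟨ cong (f v +_) (+-comm _ k) ⟩
  f v + (k + sum (f ∘ punchIn v))    ≡⟨ +-assoc (f v) k _ ⟨
  f v + k + sum (f ∘ punchIn v)      ≤⟨ +-mono-≤ fv+k≤gv (sum-mono-≤ (f≤g ∘ punchIn v)) ⟩
  g v + sum (g ∘ punchIn v)          ≡⟨ sum-remove {i = v} g ⟨
  sum g                              ∎
  where open ≤-Reasoning

indicator : ∀ {a} {A : Set a} → Dec A → ℕ
indicator (yes _) = 1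
indicator (no _)  = 0

indicator≤1 : ∀ {a} {A : Set a} (a? : Dec A) → indicator a? ≤ 1
indicator≤1 (yes _) = ≤-refl
indicator≤1 (no _)  = z≤n

indicator-mono : ∀ {a b} {A : Set a} {B : Set b} (a? : Dec A) (b? : Dec B) → (A → B) → indicator a? ≤ indicator b?
indicator-mono (no _)  _       _   = z≤n
indicator-mono (yes _) (yes _) _   = ≤-refl
indicator-mono (yes a) (no ¬b) A⇒B = contradiction (A⇒B a) ¬b

indicator-yes : ∀ {a} {A : Set a} (a? : Dec A) → A → indicator a? ≡ 1
indicator-yes (yes _) _ = refl
indicator-yes (no ¬a) a = contradiction a ¬a

indicator-no : ∀ {a} {A : Set a} (a? : Dec A) → ¬ A → indicator a? ≡ 0
indicator-no (yes a) ¬a = contradiction a ¬a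
indicator-no (no _)  _  = refl

count : ∀ {n p} {P : Pred (Fin n) p} → Decidable P → ℕ
count P? = sum (λ i → indicator (P? i))

count-mono : ∀ {n p q} {P : Pred (Fin n) p} {Q : Pred (Fin n) q} (P? : Decidable P) (Q? : Decidable Q) →
             (∀ {i} → P i → Q i) → count P? ≤ count Q?
count-mono P? Q? P⇒Q = sum-mono-≤ λ i → indicator-mono (P? i) (Q? i) P⇒Q

count-empty : ∀ {n p} {P : Pred (Fin n) p} (P? : Decidable P) → (∀ i → ¬ P i) → count P? ≡ 0
count-empty {n} P? ¬P = trans (sum-cong-≗ (λ i → indicator-no (P? i) (¬P i))) (sum-replicate-zero n)

count-≡ : ∀ {n} (x : Fin n) → count (x ≟ᶠ_) ≡ 1
count-≡ {suc n} x = begin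
  count (x ≟ᶠ_)                                        ≡⟨ sum-remove {i = x} (λ i → indicator (x ≟ᶠ i)) ⟩
  indicator (x ≟ᶠ x) + count (λ i → x ≟ᶠ punchIn x i)  ≡⟨ cong₂ _+_ (indicator-yes (x ≟ᶠ x) refl) none ⟩
  1                                                    ∎
  where
    open ≡-Reasoning
    none = count-empty (λ i → x ≟ᶠ punchIn x i) (λ i → punchInᵢ≢i x i ∘ sym)

count-≤1 : ∀ {n p} {P : Pred (Fin n) p} (P? : Decidable P) x → (∀ {i} → P i → x ≡ i) → count P? ≤ 1
count-≤1 P? x P⇒≡x = ≤-trans (count-mono P? (x ≟ᶠ_) P⇒≡x) (≤-reflexive (count-≡ x))

count-⊎ : ∀ {n p q} {P : Pred (Fin n) p} {Q : Pred (Fin n) q} (P? : Decidable P) (Q? : Decidable Q) →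
          (∀ {i} → P i → ¬ Q i) → count (λ i → P? i ⊎-dec Q? i) ≡ count P? + count Q?
count-⊎ P? Q? P⇒¬Q = trans (sum-cong-≗ indicator-⊎) (sum-+ (λ i → indicator (P? i)) (λ i → indicator (Q? i)))
  where
    indicator-⊎ : ∀ i → indicator (P? i ⊎-dec Q? i) ≡ indicator (P? i) + indicator (Q? i)
    indicator-⊎ i with P? i | Q? i
    ... | yes Pi | yes Qi = contradiction Qi (P⇒¬Q Pi)
    ... | yes _  | no _   = refl
    ... | no _   | yes _  = refl
    ... | no _   | no _   = refl

count-< : ∀ {n p} {P : Pred (Fin n) p} (P? : Decidable P) v → ¬ P v → count P? < n
count-< {suc n} P? v ¬Pv = begin-strict
  count P?                                            ≡⟨ sum-remove {i = v} (λ i → indicator (P? i)) ⟩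
  indicator (P? v) + count (λ i → P? (punchIn v i))  ≡⟨ cong (_+ count (λ i → P? (punchIn v i))) (indicator-no (P? v) ¬Pv) ⟩
  count (λ i → P? (punchIn v i))                      ≤⟨ sum-≤-* 1 (λ i → indicator≤1 (P? (punchIn v i))) ⟩
  n * 1                                               ≡⟨ *-identityʳ n ⟩
  n                                                   <⟨ n<1+n n ⟩
  suc n                                               ∎
  where open ≤-Reasoning

count-+-length : ∀ {n p q} {P : Pred (Fin n) p} {Q : Pred (Fin n) q} (P? : Decidable P) (Q? : Decidable Q) →
                 (∀ {i} → Q i → P i) → ∀ {xs} → Unique xs → All (λ i → P i × ¬ Q i) xs →
                 count Q? + length xs ≤ count P?
count-+-length P? Q? Q⇒P {[]} _ _ = ≤-trans (≤-reflexive (+-identityʳ _)) (count-mono Q? P? Q⇒P)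
count-+-length {P = P} {Q} P? Q? Q⇒P {x ∷ xs} (x∉xs ∷ !xs) ((Px , ¬Qx) ∷ PxsQxs) = begin
  count Q? + suc (length xs)  ≡⟨ +-suc _ _ ⟩
  suc (count Q? + length xs)  ≤⟨ s≤s (count-+-length P′? Q? Q⇒P′ !xs (All.zipWith P′xs (x∉xs , PxsQxs))) ⟩
  suc (count P′?)             ≡⟨ +-comm 1 _ ⟩
  count P′? + 1               ≤⟨ sum-+-≤ (λ i → indicator-mono (P′? i) (P? i) proj₁) x x-counted ⟩
  count P?                    ∎
  where
    open ≤-Reasoning
    P′? : Decidable (λ i → P i × x ≢ i)
    P′? i = P? i ×-dec ¬? (x ≟ᶠ i)
    Q⇒P′ : ∀ {i} → Q i → P i × x ≢ i
    Q⇒P′ Qi = Q⇒P Qi , λ { refl → ¬Qx Qi }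
    P′xs : ∀ {i} → x ≢ i × (P i × ¬ Q i) → (P i × x ≢ i) × ¬ Q i
    P′xs (x≢i , Pi , ¬Qi) = (Pi , x≢i) , ¬Qi
    x-counted : indicator (P′? x) + 1 ≤ indicator (P? x)
    x-counted = ≤-reflexive (trans (cong (_+ 1) (indicator-no (P′? x) (λ (_ , x≢x) → x≢x refl)))
                                   (sym (indicator-yes (P? x) Px)))

take-++ˡ : ∀ {a} {A : Set a} n (xs ys : List A) → n ≤ length xs → take n (xs ++ ys) ≡ take n xs
take-++ˡ zero    xs       ys _         = refl
take-++ˡ (suc n) (x ∷ xs) ys (s≤s n≤∣xs∣) = cong (x ∷_) (take-++ˡ n xs ys n≤∣xs∣)

∈-take-++ : ∀ {a} {A : Set a} n {xs : List A} ys {x} → length xs ≤ n → x ∈ xs → x ∈ take n (xs ++ ys)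
∈-take-++ (suc n) ys _            (here refl) = here refl
∈-take-++ (suc n) ys (s≤s ∣xs∣≤n) (there x∈xs) = there (∈-take-++ n ys ∣xs∣≤n x∈xs)

degree : ∀ {N} → List (Edge N) → Fin N → ℕ
degree S v = count (edgeIn? S v)

degree-mono : ∀ {N} {S S′ : List (Edge N)} v → (∀ {u} → EdgeIn S v u → EdgeIn S′ v u) → degree S v ≤ degree S′ v
degree-mono {S = S} {S′} v = count-mono (edgeIn? S v) (edgeIn? S′ v)

degree-[] : ∀ {N} (v : Fin N) → degree [] v ≡ 0
degree-[] v = count-empty (edgeIn? [] v) (λ _ ())

incidences : ∀ {N} → List (Edge N) → Fin N → ℕ
incidences []      v = 0
incidences (e ∷ L) v = indicator (incidentTo? v e) + incidences L v

incidences≤length : ∀ {N} (L : List (Edge N)) v → incidences L v ≤ length L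
incidences≤length []      v = z≤n
incidences≤length (e ∷ L) v = +-mono-≤ (indicator≤1 (incidentTo? v e)) (incidences≤length L v)

count-incidentTo : ∀ {N} (e : Edge N) → count (λ v → incidentTo? v e) ≡ 2
count-incidentTo ((i , j) , i<j) =
  trans (count-⊎ (i ≟ᶠ_) (j ≟ᶠ_) λ { refl refl → <-irrefl refl i<j }) (cong₂ _+_ (count-≡ i) (count-≡ j))

sum-incidences : ∀ {N} (L : List (Edge N)) → sum (incidences L) ≡ length L * 2
sum-incidences {N} []      = sum-replicate-zero N
sum-incidences     (e ∷ L) = begin
  sum (incidences (e ∷ L))                      ≡⟨ sum-+ (λ v → indicator (incidentTo? v e)) (incidences L) ⟩
  count (λ v → incidentTo? v e) + sum (incidences L)  ≡⟨ cong₂ _+_ (count-incidentTo e) (sum-incidences L) ⟩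
  2 + length L * 2                              ∎
  where open ≡-Reasoning

degree-∷ : ∀ {N} (e : Edge N) S v → degree (e ∷ S) v ≤ degree S v + indicator (incidentTo? v e)
degree-∷ e S v = begin
  degree (e ∷ S) v                                                     ≤⟨ sum-mono-≤ split ⟩
  sum (λ u → indicator (edgeIn? S v u) + indicator (joins? e v u))     ≡⟨ sum-+ (λ u → indicator (edgeIn? S v u)) _ ⟩
  degree S v + count (joins? e v)                                      ≤⟨ +-monoʳ-≤ (degree S v) joins-count ⟩
  degree S v + indicator (incidentTo? v e)                             ∎
  where
    open ≤-Reasoning
    split : ∀ u → indicator (edgeIn? (e ∷ S) v u) ≤ indicator (edgeIn? S v u) + indicator (joins? e v u)
    split u with edgeIn? (e ∷ S) v u
    ... | no  _            = z≤n
    ... | yes (here e~)    = ≤-trans (≤-reflexive (sym (indicator-yes (joins? e v u) e~))) (m≤n+m _ _)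
    ... | yes (there vu∈S) = ≤-trans (≤-reflexive (sym (indicator-yes (edgeIn? S v u) vu∈S))) (m≤m+n _ _)
    joins-count : count (joins? e v) ≤ indicator (incidentTo? v e)
    joins-count with incidentTo? v e
    ... | yes _   = count-≤1 (joins? e v) (otherEnd v e) (joins⇒otherEnd e)
    ... | no  v∉e = ≤-reflexive (count-empty (joins? e v) λ _ e~ → v∉e (joins⇒incidentTo e e~))

degree-++ : ∀ {N} (L S : List (Edge N)) v → degree (L ++ S) v ≤ degree S v + incidences L v
degree-++ []      S v = m≤m+n (degree S v) 0
degree-++ (e ∷ L) S v = begin
  degree (e ∷ L ++ S) v                                           ≤⟨ degree-∷ e (L ++ S) v ⟩
  degree (L ++ S) v + indicator (incidentTo? v e)                 ≤⟨ +-monoˡ-≤ _ (degree-++ L S v) ⟩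
  degree S v + incidences L v + indicator (incidentTo? v e)       ≡⟨ +-assoc (degree S v) _ _ ⟩
  degree S v + (incidences L v + indicator (incidentTo? v e))     ≡⟨ cong (degree S v +_) (+-comm (incidences L v) _) ⟩
  degree S v + incidences (e ∷ L) v                               ∎
  where open ≤-Reasoning

EdgeIn-disjoint : ∀ {N} {S R : List (Edge N)} → Disjoint S R → ∀ {x y} → EdgeIn S x y → ¬ EdgeIn R x y
EdgeIn-disjoint S∩R=∅ xy∈S xy∈R = let e , e∈S , e~ = find xy∈S in S∩R=∅ (e∈S , joins-∈ e~ xy∈R)

¬EdgeIn-loop : ∀ {N} (S : List (Edge N)) v → ¬ EdgeIn S v v
¬EdgeIn-loop S v vv∈S = let e , _ , e~ = find vv∈S in joins⇒≢ e e~ refl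

degree+degree<N : ∀ {N} {S R : List (Edge N)} → Disjoint S R → ∀ v → degree S v + degree R v < N
degree+degree<N {S = S} {R} S∩R=∅ v = subst (_< _) (count-⊎ (edgeIn? S v) (edgeIn? R v) (EdgeIn-disjoint S∩R=∅))
  (count-< (λ u → edgeIn? S v u ⊎-dec edgeIn? R v u) v λ { (inj₁ vv∈S) → ¬EdgeIn-loop S v vv∈S
                                                          ; (inj₂ vv∈R) → ¬EdgeIn-loop R v vv∈R })

star-centre-degree : ∀ {n N} {S : List (Edge N)} → ContainsCopy (Star n) S → ∃[ c ] n ≤ degree S c
star-centre-degree {n} {N} {S} (f , f-injective , f-adjacent) = c , (begin
  n                                    ≡⟨ List.length-tabulate leaves ⟨
  length (tabulate leaves)             ≡⟨ cong (_+ length (tabulate leaves)) (count-empty none (λ _ ())) ⟨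
  count none + length (tabulate leaves) ≤⟨ count-+-length (edgeIn? S c) none (λ ()) leaves-unique leaves-adjacent ⟩
  degree S c                         ∎)
  where
    open ≤-Reasoning
    c = f fzero
    leaves = f ∘ fsuc
    none : Decidable {A = Fin N} ∅
    none = ∅?
    leaves-unique : Unique (tabulate leaves)
    leaves-unique = Unique.tabulate⁺ (fsuc-injective ∘ f-injective)
    leaves-adjacent : All (λ u → EdgeIn S c u × ¬ ∅ u) (tabulate leaves)
    leaves-adjacent = All.tabulate⁺ λ i → f-adjacent fzero (fsuc i) (inj₁ (refl , λ ())) , λ ()

m+n∸o≤m∸o+n : ∀ m n o → m + n ∸ o ≤ m ∸ o + n
m+n∸o≤m∸o+n m n o = m≤n+o⇒m∸n≤o (m + n) o (begin
  m + n             ≤⟨ +-monoˡ-≤ n (m≤n+m∸n m o) ⟩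
  o + (m ∸ o) + n   ≡⟨ +-assoc o (m ∸ o) n ⟩
  o + (m ∸ o + n)   ∎)
  where open ≤-Reasoning

∸-+-≤-∸ : ∀ {a b} t k → b ≤ a ∸ k → t + k ≤ a → b ∸ t + k ≤ a ∸ t
∸-+-≤-∸ {a} {b} t k b≤a∸k t+k≤a = begin
  b ∸ t + k        ≤⟨ +-monoˡ-≤ k (∸-monoˡ-≤ t b≤a∸k) ⟩
  a ∸ k ∸ t + k    ≡⟨ cong (_+ k) (∸-+-assoc a k t) ⟩
  a ∸ (k + t) + k  ≡⟨ cong (λ x → a ∸ x + k) (+-comm k t) ⟩
  a ∸ (t + k) + k  ≡⟨ cong (_+ k) (∸-+-assoc a t k) ⟨
  a ∸ t ∸ k + k    ≡⟨ m∸n+n≡m (m+n≤o⇒m≤o∸n k (≤-trans (≤-reflexive (+-comm k t)) t+k≤a)) ⟩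
  a ∸ t            ∎
  where open ≤-Reasoning

2*[m∸2k]≤m : ∀ m k → m ≤ 2 * k + k → 2 * (m ∸ 2 * k) ≤ m
2*[m∸2k]≤m m k m≤3k with m ≤? 2 * k
... | yes m≤2k = ≤-trans (≤-reflexive (cong (2 *_) (m≤n⇒m∸n≡0 m≤2k))) z≤n
... | no  m≰2k = begin
  2 * z          ≡⟨ cong (z +_) (+-identityʳ z) ⟩
  z + z          ≤⟨ +-monoʳ-≤ z (≤-trans z≤k (m≤m+n k (k + 0))) ⟩
  z + 2 * k      ≡⟨ z+2k≡m ⟩
  m              ∎
  where
    open ≤-Reasoning
    z = m ∸ 2 * k
    z+2k≡m : z + 2 * k ≡ m
    z+2k≡m = m∸n+n≡m (<⇒≤ (≰⇒> m≰2k))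
    z≤k : z ≤ k
    z≤k = +-cancelʳ-≤ (2 * k) z k (≤-trans (≤-reflexive z+2k≡m) (≤-trans m≤3k (≤-reflexive (+-comm (2 * k) k))))

-- Potentials at thresholds

Φ : ∀ {N} → ℕ → (Fin N → ℕ) → ℕ
Φ t f = sum (λ v → f v ∸ t)

module Potential {N : ℕ} (k : ℕ) where

  threshold : ℕ → ℕ
  threshold j = j * (2 * k)

  -- Φ at threshold j is at most kN/2^j + 2k.
  Bounded : ℕ → ℕ → Set
  Bounded j x = 2 ^ j * x ≤ k * N + 2 ^ j * (2 * k)

  Bounded-≤ : ∀ {j x y} → x ≤ y → Bounded j y → Bounded j x
  Bounded-≤ {j} x≤y = ≤-trans (*-monoʳ-≤ (2 ^ j) x≤y)

  Bounded-zero : ∀ {x} → x ≤ N * k → Bounded 0 x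
  Bounded-zero {x} x≤Nk = begin
    1 * x                ≡⟨ *-identityˡ x ⟩
    x                    ≤⟨ x≤Nk ⟩
    N * k                ≡⟨ *-comm N k ⟩
    k * N                ≤⟨ m≤m+n (k * N) _ ⟩
    k * N + 1 * (2 * k)  ∎
    where open ≤-Reasoning

  Bounded-suc : ∀ {j x y} → Bounded j x → 2 * y ≤ x + k → Bounded (suc j) y
  Bounded-suc {j} {x} {y} bx 2y≤x+k = begin
    2 ^ suc j * y                        ≡⟨ double-inside (2 ^ j) y ⟩
    2 ^ j * (2 * y)                      ≤⟨ *-monoʳ-≤ (2 ^ j) 2y≤x+k ⟩
    2 ^ j * (x + k)                      ≡⟨ *-distribˡ-+ (2 ^ j) x k ⟩
    2 ^ j * x + 2 ^ j * k                ≤⟨ +-monoˡ-≤ _ bx ⟩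
    k * N + 2 ^ j * (2 * k) + 2 ^ j * k  ≤⟨ regroup (k * N) (2 ^ j) k ⟩
    k * N + 2 ^ suc j * (2 * k)          ∎
    where
      open ≤-Reasoning
      double-inside : ∀ a y → 2 * a * y ≡ a * (2 * y)
      double-inside = solve-∀
      regroup : ∀ c a k → c + a * (2 * k) + a * k ≤ c + 2 * a * (2 * k)
      regroup c a k = ≤-trans (+-monoʳ-≤ (c + a * (2 * k)) (*-monoʳ-≤ a (m≤m+n k (k + 0))))
                              (≤-reflexive (add-halves c a k))
        where
          add-halves : ∀ c a k → c + a * (2 * k) + a * (2 * k) ≡ c + 2 * a * (2 * k)
          add-halves = solve-∀

  Bounded⇒≤ : ∀ {j x} → k * N < 2 ^ j → Bounded j x → x ≤ 2 * k
  Bounded⇒≤ {j} {x} kN<2^j bx = ≤-pred (*-cancelˡ-< (2 ^ j) x (suc (2 * k)) (begin-strict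
    2 ^ j * x                ≤⟨ bx ⟩
    k * N + 2 ^ j * (2 * k)  <⟨ +-monoˡ-< _ kN<2^j ⟩
    2 ^ j + 2 ^ j * (2 * k)  ≡⟨ *-suc (2 ^ j) (2 * k) ⟨
    2 ^ j * suc (2 * k)      ∎))
    where open ≤-Reasoning

  -- A round on the weights: Alice raises s₀ to s at a cost of at most k at every threshold, then Bob lowers s
  -- pointwise to s′, by at least k at a maximum vs of s.
  module Round (s₀ s s′ : Fin N → ℕ) (raise : ∀ t → Φ t s ≤ Φ t s₀ + k)
               (vs : Fin N) (vs-max : ∀ v → s v ≤ s vs)
               (lower : ∀ v → s′ v ≤ s v) (pay : s′ vs ≤ s vs ∸ k) where

    Φ-lower-≤ : ∀ t → t + k ≤ s vs → Φ t s′ ≤ Φ t s₀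
    Φ-lower-≤ t t+k≤svs = +-cancelʳ-≤ k _ _ (begin
      Φ t s′ + k  ≤⟨ sum-+-≤ (λ v → ∸-monoˡ-≤ t (lower v)) vs (∸-+-≤-∸ t k pay t+k≤svs) ⟩
      Φ t s       ≤⟨ raise t ⟩
      Φ t s₀ + k  ∎)
      where open ≤-Reasoning

    2Φ-lower-≤ : ∀ t → s vs < 2 * k + t + k → 2 * Φ (2 * k + t) s′ ≤ Φ t s₀ + k
    2Φ-lower-≤ t svs<t+3k = begin
      2 * Φ (2 * k + t) s′  ≡⟨ *-distribˡ-sum 2 (λ v → s′ v ∸ (2 * k + t)) ⟩
      sum (λ v → 2 * (s′ v ∸ (2 * k + t)))  ≤⟨ sum-mono-≤ halve ⟩
      Φ t s                 ≤⟨ raise t ⟩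
      Φ t s₀ + k            ∎
      where
        open ≤-Reasoning
        halve : ∀ v → 2 * (s′ v ∸ (2 * k + t)) ≤ s v ∸ t
        halve v = begin
          2 * (s′ v ∸ (2 * k + t))  ≤⟨ *-monoʳ-≤ 2 (∸-monoˡ-≤ (2 * k + t) (lower v)) ⟩
          2 * (s v ∸ (2 * k + t))   ≡⟨ cong (λ x → 2 * (s v ∸ x)) (+-comm (2 * k) t) ⟩
          2 * (s v ∸ (t + 2 * k))   ≡⟨ cong (2 *_) (∸-+-assoc (s v) t (2 * k)) ⟨
          2 * (s v ∸ t ∸ 2 * k)     ≤⟨ 2*[m∸2k]≤m (s v ∸ t) k (m≤n+o⇒m∸n≤o (s v) t sv≤t+3k) ⟩
          s v ∸ t                   ∎
          where
            sv≤t+3k : s v ≤ t + (2 * k + k)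
            sv≤t+3k = ≤-trans (vs-max v) (≤-trans (<⇒≤ svs<t+3k) (≤-reflexive (rearrange t k)))
              where
                rearrange : ∀ t k → 2 * k + t + k ≡ t + (2 * k + k)
                rearrange = solve-∀

    Bounded-step : ∀ j → (∀ i → i ≤ j → Bounded i (Φ (threshold i) s₀)) → Bounded j (Φ (threshold j) s′)
    Bounded-step j bounded with threshold j + k ≤? s vs
    ... | yes t+k≤svs = Bounded-≤ {j} (Φ-lower-≤ (threshold j) t+k≤svs) (bounded j ≤-refl)
    Bounded-step zero    bounded | no svs<k = Bounded-zero (sum-≤-* k λ v → <⇒≤ (begin-strict
      s′ v ∸ 0  ≤⟨ lower v ⟩
      s v       ≤⟨ vs-max v ⟩
      s vs      <⟨ ≰⇒> svs<k ⟩
      k         ∎))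
      where open ≤-Reasoning
    Bounded-step (suc j) bounded | no svs<t+k =
      Bounded-suc {j} (bounded j (n≤1+n j)) (2Φ-lower-≤ (threshold j) (≰⇒> svs<t+k))

-- Bob's move

Live : ∀ {N} → List (Edge N) → List (Edge N) → Fin N → Set
Live B R v = ∃ λ u → u ≢ v × ¬ EdgeIn B v u × ¬ EdgeIn R v u

live? : ∀ {N} (B R : List (Edge N)) v → Dec (Live B R v)
live? B R v = any? λ u → ¬? (u ≟ᶠ v) ×-dec ¬? (edgeIn? B v u) ×-dec ¬? (edgeIn? R v u)

Live-anti : ∀ {N} {B B′ R R′ : List (Edge N)} {v} → (∀ {u} → EdgeIn B v u → EdgeIn B′ v u) →
            (∀ {u} → EdgeIn R v u → EdgeIn R′ v u) → Live B′ R′ v → Live B R v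
Live-anti B⊆B′ R⊆R′ (u , u≢v , vu∉B′ , vu∉R′) = u , u≢v , vu∉B′ ∘ B⊆B′ , vu∉R′ ∘ R⊆R′

module BobsMove {N} (q : ℕ) (B R : List (Edge N)) (v : Fin N) where

  open DecMembership (_≟ₑ_ {N}) using (_∈?_)

  free? : Decidable (Free B R)
  free? e = ¬? (e ∈? B) ×-dec ¬? (e ∈? R)

  freeEdges : List (Edge N)
  freeEdges = deduplicate _≟ₑ_ (filter free? (allEdges N))

  freeEdges-unique : Unique freeEdges
  freeEdges-unique = Unique.deduplicate-! _≟ₑ_ (filter free? (allEdges N))

  freeEdges-free : All (Free B R) freeEdges
  freeEdges-free = All.tabulate λ e∈ →
    proj₂ (∈.∈-filter⁻ free? {xs = allEdges N} (∈.∈-deduplicate⁻ _≟ₑ_ (filter free? (allEdges N)) e∈))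

  ∈-freeEdges : ∀ {e} → Free B R e → e ∈ freeEdges
  ∈-freeEdges e-free = ∈.∈-deduplicate⁺ _≟ₑ_ (∈.∈-filter⁺ free? (∈-allEdges _) e-free)

  atV elsewhere : List (Edge N)
  atV       = filter (incidentTo? v) freeEdges
  elsewhere = filter (¬? ∘ incidentTo? v) freeEdges

  candidates : List (Edge N)
  candidates = atV ++ elsewhere

  redEdges : List (Edge N)
  redEdges = take q candidates

  candidates-unique : Unique candidates
  candidates-unique = Unique.++⁺ (Unique.filter⁺ (incidentTo? v) freeEdges-unique)
                                 (Unique.filter⁺ (¬? ∘ incidentTo? v) freeEdges-unique)
                                 (λ (e∈atV , e∈elsewhere) →
                                   proj₂ (∈.∈-filter⁻ (¬? ∘ incidentTo? v) {xs = freeEdges} e∈elsewhere)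
                                         (proj₂ (∈.∈-filter⁻ (incidentTo? v) {xs = freeEdges} e∈atV)))

  candidates-free : All (Free B R) candidates
  candidates-free = All.++⁺ (All.filter⁺ (incidentTo? v) freeEdges-free) (All.filter⁺ (¬? ∘ incidentTo? v) freeEdges-free)

  ∈-candidates : ∀ {e} → Free B R e → e ∈ candidates
  ∈-candidates {e} e-free with incidentTo? v e
  ... | yes v∈e = ∈.∈-++⁺ˡ (∈.∈-filter⁺ (incidentTo? v) (∈-freeEdges e-free) v∈e)
  ... | no  v∉e = ∈.∈-++⁺ʳ atV (∈.∈-filter⁺ (¬? ∘ incidentTo? v) (∈-freeEdges e-free) v∉e)

  redEdges-valid : ValidMove q B R redEdges
  redEdges-valid = Unique.take⁺ q candidates-unique , All.take⁺ q candidates-free , redEdges-length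
    where
      redEdges-length : length redEdges ≡ q ⊎ (length redEdges < q × (∀ e → Free B R e → e ∈ redEdges))
      redEdges-length with q ≤? length candidates
      ... | yes q≤∣c∣ = inj₁ (trans (List.length-take q candidates) (m≤n⇒m⊓n≡m q≤∣c∣))
      ... | no  q≰∣c∣ rewrite List.take-all q candidates (<⇒≤ (≰⇒> q≰∣c∣)) =
        inj₂ (≰⇒> q≰∣c∣ , λ _ → ∈-candidates)

  redEdges-effect : ¬ Live B (redEdges ++ R) v ⊎ degree R v + q ≤ degree (redEdges ++ R) v
  redEdges-effect with q ≤? length atV
  ... | yes q≤∣atV∣ = inj₂ (subst (λ m → degree R v + m ≤ degree (redEdges ++ R) v) length-neighbours
          (count-+-length (edgeIn? (redEdges ++ R) v) (edgeIn? R v) (Any.++⁺ʳ redEdges) neighbours-unique neighbours-new))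
    where
      redEdges≡ : redEdges ≡ take q atV
      redEdges≡ = take-++ˡ q atV elsewhere q≤∣atV∣
      taken-at-v : All (IncidentTo v) (take q atV)
      taken-at-v = All.take⁺ q (All.all-filter (incidentTo? v) freeEdges)
      neighbours = map (otherEnd v) (take q atV)
      length-neighbours : length neighbours ≡ q
      length-neighbours = trans (List.length-map (otherEnd v) (take q atV))
                                (trans (List.length-take q atV) (m≤n⇒m⊓n≡m q≤∣atV∣))
      neighbours-unique : Unique neighbours
      neighbours-unique = otherEnds-unique (Unique.take⁺ q (Unique.filter⁺ (incidentTo? v) freeEdges-unique)) taken-at-v
      neighbours-new : All (λ u → EdgeIn (redEdges ++ R) v u × ¬ EdgeIn R v u) neighbours
      neighbours-new = All.map⁺ (All.tabulate λ e∈taken →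
        new e∈taken (All.lookup taken-at-v e∈taken) (All.lookup taken-free e∈taken))
        where
          taken-free : All (Free B R) (take q atV)
          taken-free = subst (All (Free B R)) redEdges≡ (All.take⁺ q candidates-free)
          new : ∀ {e} → e ∈ take q atV → IncidentTo v e → Free B R e →
                EdgeIn (redEdges ++ R) v (otherEnd v e) × ¬ EdgeIn R v (otherEnd v e)
          new {e} e∈taken v∈e (_ , e∉R) =
            Any.++⁺ˡ (lose (subst (e ∈_) (sym redEdges≡) e∈taken) e~) , e∉R ∘ joins-∈ e~
            where e~ = joins-otherEnd e v∈e
  ... | no  q≰∣atV∣ = inj₁ λ (u , u≢v , vu∉B , vu∉M++R) →
          let e , e~ = edgeBetween (u≢v ∘ sym)
              e-free : Free B R e
              e-free = vu∉B ∘ (λ e∈B → lose e∈B e~) , vu∉M++R ∘ Any.++⁺ʳ redEdges ∘ (λ e∈R → lose e∈R e~)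
              e∈atV = ∈.∈-filter⁺ (incidentTo? v) (∈-freeEdges e-free) (joins⇒incidentTo e e~)
          in vu∉M++R (Any.++⁺ˡ (lose (∈-take-++ q elsewhere (<⇒≤ (≰⇒> q≰∣atV∣)) e∈atV) e~))

-- Danger of a vertex

keepIf : ∀ {a} {A : Set a} → Dec A → ℕ → ℕ
keepIf (yes _) x = x
keepIf (no _)  _ = 0

keepIf≤ : ∀ {a} {A : Set a} (a? : Dec A) x → keepIf a? x ≤ x
keepIf≤ (yes _) x = ≤-refl
keepIf≤ (no _)  x = z≤n

keepIf-mono : ∀ {a b} {A : Set a} {B : Set b} (a? : Dec A) (b? : Dec B) {x y c} →
              (B → A) → x ≤ y + c → keepIf b? x ≤ keepIf a? y + c
keepIf-mono _       (no _)  _   _     = z≤n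
keepIf-mono (yes _) (yes _) _   x≤y+c = x≤y+c
keepIf-mono (no ¬a) (yes b) B⇒A _     = contradiction (B⇒A b) ¬a

module Danger (p q : ℕ) {N : ℕ} where

  danger : List (Edge N) → List (Edge N) → Fin N → ℕ
  danger B R v = q * degree B v ∸ 2 * p * degree R v

  score : List (Edge N) → List (Edge N) → Fin N → ℕ
  score B R v = keepIf (live? B R v) (danger B R v)

  score-live : ∀ {B R v} → Live B R v → score B R v ≡ danger B R v
  score-live {B} {R} {v} live with live? B R v
  ... | yes _    = refl
  ... | no  dead = contradiction live dead

  danger-++ : ∀ L B R v → danger (L ++ B) R v ≤ danger B R v + q * incidences L v
  danger-++ L B R v = begin
    q * degree (L ++ B) v ∸ r                  ≤⟨ ∸-monoˡ-≤ r (*-monoʳ-≤ q (degree-++ L B v)) ⟩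
    q * (degree B v + incidences L v) ∸ r      ≡⟨ cong (_∸ r) (*-distribˡ-+ q (degree B v) _) ⟩
    q * degree B v + q * incidences L v ∸ r    ≤⟨ m+n∸o≤m∸o+n (q * degree B v) _ r ⟩
    danger B R v + q * incidences L v          ∎
    where
      open ≤-Reasoning
      r = 2 * p * degree R v

  danger-antitone : ∀ B {R R′} v → (∀ {u} → EdgeIn R v u → EdgeIn R′ v u) → danger B R′ v ≤ danger B R v
  danger-antitone B v R⊆R′ = ∸-monoʳ-≤ (q * degree B v) (*-monoʳ-≤ (2 * p) (degree-mono v R⊆R′))

  -- Every edge at a dead vertex is already coloured, so Alice's free edges miss it.
  danger-dead : ∀ {L B R v} → ¬ Live B R v → All (Free B R) L → danger (L ++ B) R v ≤ danger B R v
  danger-dead {L} {B} {R} {v} dead L-free = ∸-monoˡ-≤ (2 * p * degree R v) (*-monoʳ-≤ q (degree-mono v old))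
    where
      old : ∀ {u} → EdgeIn (L ++ B) v u → EdgeIn B v u
      old {u} vu∈L++B with Any.++⁻ L vu∈L++B | edgeIn? B v u | edgeIn? R v u
      ... | inj₂ vu∈B | _         | _       = vu∈B
      ... | inj₁ _    | yes vu∈B  | _       = vu∈B
      ... | inj₁ vu∈L | no vu∉B   | no vu∉R =
        contradiction (u , (λ { refl → ¬EdgeIn-loop L v vu∈L }) , vu∉B , vu∉R) dead
      ... | inj₁ vu∈L | no _      | yes vu∈R =
        let e , e∈L , e~ = find vu∈L in contradiction (joins-∈ e~ vu∈R) (proj₂ (All.lookup L-free e∈L))

  score-++ : ∀ L B R v → score (L ++ B) R v ≤ score B R v + q * incidences L v
  score-++ L B R v =
    keepIf-mono (live? B R v) (live? (L ++ B) R v) (Live-anti (Any.++⁺ʳ L) (λ vu∈R → vu∈R)) (danger-++ L B R v)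

  score-antitone : ∀ B {R R′} v → (∀ {u} → EdgeIn R v u → EdgeIn R′ v u) → score B R′ v ≤ score B R v
  score-antitone B {R} {R′} v R⊆R′ = ≤-trans
    (keepIf-mono (live? B R v) (live? B R′ v) (Live-anti (λ vu∈B → vu∈B) R⊆R′)
                 (≤-trans (danger-antitone B v R⊆R′) (≤-reflexive (sym (+-identityʳ _)))))
    (≤-reflexive (+-identityʳ _))

  score-pay : ∀ B R M v → ¬ Live B (M ++ R) v ⊎ degree R v + q ≤ degree (M ++ R) v →
              score B (M ++ R) v ≤ score B R v ∸ 2 * p * q
  score-pay B R M v effect with live? B (M ++ R) v | live? B R v | effect
  ... | no _     | _      | _            = z≤n
  ... | yes live | no dead | _           = contradiction (Live-anti (λ vu∈B → vu∈B) (Any.++⁺ʳ M) live) dead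
  ... | yes live | yes _  | inj₁ dead    = contradiction live dead
  ... | yes _    | yes _  | inj₂ paid    = begin
    q * degree B v ∸ 2 * p * degree (M ++ R) v     ≤⟨ ∸-monoʳ-≤ (q * degree B v) (*-monoʳ-≤ (2 * p) paid) ⟩
    q * degree B v ∸ 2 * p * (degree R v + q)      ≡⟨ cong (q * degree B v ∸_) (*-distribˡ-+ (2 * p) (degree R v) q) ⟩
    q * degree B v ∸ (2 * p * degree R v + 2 * p * q)  ≡⟨ ∸-+-assoc (q * degree B v) (2 * p * degree R v) (2 * p * q) ⟨
    danger B R v ∸ 2 * p * q                       ∎
    where open ≤-Reasoning

  Φ-++ : ∀ t L B R → Φ t (score (L ++ B) R) ≤ Φ t (score B R) + q * (length L * 2)
  Φ-++ t L B R = begin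
    Φ t (score (L ++ B) R)                                  ≤⟨ sum-mono-≤ pointwise ⟩
    sum (λ v → (score B R v ∸ t) + q * incidences L v)      ≡⟨ sum-+ (λ v → score B R v ∸ t) _ ⟩
    Φ t (score B R) + sum (λ v → q * incidences L v)        ≡⟨ cong (Φ t (score B R) +_) (*-distribˡ-sum q (incidences L)) ⟨
    Φ t (score B R) + q * sum (incidences L)                ≡⟨ cong (λ x → Φ t (score B R) + q * x) (sum-incidences L) ⟩
    Φ t (score B R) + q * (length L * 2)                    ∎
    where
      open ≤-Reasoning
      pointwise : ∀ v → score (L ++ B) R v ∸ t ≤ (score B R v ∸ t) + q * incidences L v
      pointwise v = ≤-trans (∸-monoˡ-≤ t (score-++ L B R v)) (m+n∸o≤m∸o+n (score B R v) _ t)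

-- Bob's strategy

ValidMove⇒length≤ : ∀ {N m} {B R L : List (Edge N)} → ValidMove m B R L → length L ≤ m
ValidMove⇒length≤ (_ , _ , inj₁ ∣L∣≡m)       = ≤-reflexive ∣L∣≡m
ValidMove⇒length≤ (_ , _ , inj₂ (∣L∣<m , _)) = <⇒≤ ∣L∣<m

star-arithmetic : ∀ p q n b r N T → n ≤ b → b + r < N → q * b ∸ 2 * p * r ≤ T → (2 * p + q) * n ≤ 2 * p * N + T
star-arithmetic p q n b r N T n≤b b+r<N qb∸2pr≤T = begin
  (2 * p + q) * n             ≤⟨ *-monoʳ-≤ (2 * p + q) n≤b ⟩
  (2 * p + q) * b             ≡⟨ *-distribʳ-+ b (2 * p) q ⟩
  2 * p * b + q * b           ≤⟨ +-monoʳ-≤ (2 * p * b) (≤-trans (m≤n+m∸n (q * b) (2 * p * r)) (+-monoʳ-≤ _ qb∸2pr≤T)) ⟩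
  2 * p * b + (2 * p * r + T) ≡⟨ regroup p b r T ⟩
  2 * p * (b + r) + T         ≤⟨ +-monoˡ-≤ T (*-monoʳ-≤ (2 * p) (<⇒≤ b+r<N)) ⟩
  2 * p * N + T               ∎
  where
    open ≤-Reasoning
    regroup : ∀ p b r T → 2 * p * b + (2 * p * r + T) ≡ 2 * p * (b + r) + T
    regroup = solve-∀

module Strategy (p q n J N′ : ℕ) (kN<2^J : 2 * p * q * suc N′ < 2 ^ J) where

  N k T : ℕ
  N = suc N′
  k = 2 * p * q

  open Danger p q {N}
  open Potential {N} k

  T = threshold J + 3 * k

  record Invariant (B R : List (Edge N)) : Set where
    field
      disjoint : Disjoint B R
      danger≤T : ∀ v → danger B R v ≤ T
      bounded  : ∀ j → j ≤ J → Bounded j (Φ (threshold j) (score B R))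

  Invariant-[] : Invariant [] []
  Invariant-[] = record
    { disjoint = λ ()
    ; danger≤T = λ v → ≤-trans (≤-reflexive (danger≡0 {v})) z≤n
    ; bounded  = λ j _ → ≤-trans (≤-reflexive (trans (cong (2 ^ j *_) (Φ≡0 (threshold j))) (*-zeroʳ (2 ^ j)))) z≤n
    }
    where
      danger≡0 : ∀ {v} → danger [] [] v ≡ 0
      danger≡0 {v} = trans (cong (λ d → q * d ∸ 2 * p * d) (degree-[] v)) (cong₂ _∸_ (*-zeroʳ q) (*-zeroʳ (2 * p)))
      Φ≡0 : ∀ t → Φ t (score [] []) ≡ 0
      Φ≡0 t = n≤0⇒n≡0 (≤-trans (sum-mono-≤ {g = const 0} score∸t≤0) (≤-reflexive (sum-replicate-zero N)))
        where
          score∸t≤0 : ∀ v → score [] [] v ∸ t ≤ 0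
          score∸t≤0 v = ≤-trans (m∸n≤m _ t) (≤-trans (keepIf≤ (live? [] [] v) _) (≤-reflexive (danger≡0 {v})))

  module AfterAlice {B R L} (inv : Invariant B R) (L-valid : ValidMove p B R L) where
    open Invariant inv

    L-free : All (Free B R) L
    L-free = proj₁ (proj₂ L-valid)

    cost≤k : ∀ {x} → x ≤ length L * 2 → q * x ≤ k
    cost≤k {x} x≤2∣L∣ = begin
      q * x        ≤⟨ *-monoʳ-≤ q (≤-trans x≤2∣L∣ (*-monoˡ-≤ 2 (ValidMove⇒length≤ L-valid))) ⟩
      q * (p * 2)  ≡⟨ reorder q p ⟩
      k            ∎
      where
        open ≤-Reasoning
        reorder : ∀ q p → q * (p * 2) ≡ 2 * p * q
        reorder = solve-∀

    disjoint′ : Disjoint (L ++ B) R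
    disjoint′ (e∈L++B , e∈R) with ∈.∈-++⁻ L e∈L++B
    ... | inj₁ e∈L = proj₂ (All.lookup L-free e∈L) e∈R
    ... | inj₂ e∈B = disjoint (e∈B , e∈R)

    -- At a live vertex danger equals score, which exceeds the top threshold by at most the top potential, 2k.
    danger≤T′ : ∀ v → danger (L ++ B) R v ≤ T
    danger≤T′ v with live? B R v
    ... | no  dead = ≤-trans (danger-dead dead L-free) (danger≤T v)
    ... | yes live = begin
      danger (L ++ B) R v                     ≤⟨ danger-++ L B R v ⟩
      danger B R v + q * incidences L v       ≤⟨ +-mono-≤ danger≤ (cost≤k (≤-trans (incidences≤length L v) (m≤m*n (length L) 2))) ⟩
      threshold J + 2 * k + k                 ≡⟨ +-assoc (threshold J) (2 * k) k ⟩
      threshold J + (2 * k + k)               ≡⟨ cong (threshold J +_) (+-comm (2 * k) k) ⟩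
      T                                       ∎
      where
        open ≤-Reasoning
        danger≤ : danger B R v ≤ threshold J + 2 * k
        danger≤ = ≤-trans (m≤n+m∸n (danger B R v) (threshold J)) (+-monoʳ-≤ (threshold J) (begin
          danger B R v ∸ threshold J       ≡⟨ cong (_∸ threshold J) (score-live live) ⟨
          score B R v ∸ threshold J        ≤⟨ ≤-sum (λ v → score B R v ∸ threshold J) v ⟩
          Φ (threshold J) (score B R)      ≤⟨ Bounded⇒≤ {J} kN<2^J (bounded J ≤-refl) ⟩
          2 * k                            ∎))

    raise : ∀ t → Φ t (score (L ++ B) R) ≤ Φ t (score B R) + k
    raise t = ≤-trans (Φ-++ t L B R) (+-monoʳ-≤ _ (cost≤k ≤-refl))

    S : List (Edge N)
    S = L ++ B

    vs : Fin N
    vs = proj₁ (argmax (score S R))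

    open BobsMove q S R vs using (redEdges; redEdges-valid; redEdges-effect) public

    Invariant-after-Bob : Invariant S (redEdges ++ R)
    Invariant-after-Bob = record
      { disjoint = disjoint″
      ; danger≤T = λ v → ≤-trans (danger-antitone S v (Any.++⁺ʳ redEdges)) (danger≤T′ v)
      ; bounded  = λ j j≤J → Round.Bounded-step (score B R) (score S R) (score S (redEdges ++ R)) raise
                               vs (proj₂ (argmax (score S R))) (λ v → score-antitone S v (Any.++⁺ʳ redEdges))
                               (score-pay S R redEdges vs redEdges-effect)
                               j (λ i i≤j → bounded i (≤-trans i≤j j≤J))
      }
      where
        disjoint″ : Disjoint S (redEdges ++ R)
        disjoint″ (e∈S , e∈M++R) with ∈.∈-++⁻ redEdges e∈M++R
        ... | inj₁ e∈M = proj₁ (All.lookup (proj₁ (proj₂ redEdges-valid)) e∈M) e∈S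
        ... | inj₂ e∈R = disjoint′ (e∈S , e∈R)

  star⇒bound : ∀ {S R} → ContainsCopy (Star n) S → Disjoint S R → (∀ v → danger S R v ≤ T) →
               (2 * p + q) * n ≤ 2 * p * N + T
  star⇒bound {S} {R} star S∩R=∅ danger≤T =
    let c , n≤degree = star-centre-degree star
    in star-arithmetic p q n (degree S c) (degree R c) N T n≤degree (degree+degree<N S∩R=∅ c) (danger≤T c)

  win⇒bound : ∀ {B R} → MBWin p q (Star n) N B R → Invariant B R → (2 * p + q) * n ≤ 2 * p * N + T
  win⇒bound (move L L-valid (inj₁ star)) inv = star⇒bound star disjoint′ danger≤T′
    where open AfterAlice inv L-valid
  win⇒bound (move L L-valid (inj₂ next)) inv = win⇒bound (next redEdges redEdges-valid) Invariant-after-Bob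
    where open AfterAlice inv L-valid

AchWin⇒MBWin : ∀ {p q G N B R} → AchWin p q G N B R → MBWin p q G N B R
AchWin⇒MBWin (move L L-valid (inj₁ copy)) = move L L-valid (inj₁ copy)
AchWin⇒MBWin (move L L-valid (inj₂ next)) = move L L-valid (inj₂ λ M M-valid → AchWin⇒MBWin (proj₂ (next M M-valid)))

¬MBWin-K₀ : ∀ {p q n B R} → ¬ MBWin p q (Star n) 0 B R
¬MBWin-K₀ (move L L-valid (inj₁ (f , _))) with f fzero
... | ()
¬MBWin-K₀ {q = q} (move L L-valid (inj₂ next)) = ¬MBWin-K₀ (next [] ([] , [] , no-edges q))
  where
    no-edges : ∀ q → 0 ≡ q ⊎ (0 < q × (∀ (e : Edge 0) → Free _ _ e → e ∈ []))
    no-edges zero    = inj₁ refl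
    no-edges (suc q) = inj₂ (s≤s z≤n , λ { ((() , _) , _) _ })

-- Choosing the thresholds

m<2^m : ∀ m → m < 2 ^ m
m<2^m zero    = s≤s z≤n
m<2^m (suc m) = begin-strict
  1 + m            <⟨ +-mono-≤-< (m^n>0 2 m) (m<2^m m) ⟩
  2 ^ m + 2 ^ m    ≡⟨ cong (2 ^ m +_) (+-identityʳ (2 ^ m)) ⟨
  2 ^ suc m        ∎
  where open ≤-Reasoning

m*[1+j]<2^[j+m] : ∀ m j → m * suc j < 2 ^ (j + m)
m*[1+j]<2^[j+m] m zero    = ≤-trans (s≤s (≤-reflexive (*-identityʳ m))) (m<2^m m)
m*[1+j]<2^[j+m] m (suc j) = begin-strict
  m * suc (suc j)            ≡⟨ *-suc m (suc j) ⟩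
  m + m * suc j              <⟨ +-mono-≤-< (≤-trans (<⇒≤ (m<2^m m)) (^-monoʳ-≤ 2 (m≤n+m m j))) (m*[1+j]<2^[j+m] m j) ⟩
  2 ^ (j + m) + 2 ^ (j + m)  ≡⟨ cong (2 ^ (j + m) +_) (+-identityʳ _) ⟨
  2 ^ (suc j + m)            ∎
  where open ≤-Reasoning

n<[1+n/a]*a : ∀ n a .{{_ : NonZero a}} → n < suc (n ℕ./ a) * a
n<[1+n/a]*a n a = ≤-trans (s≤s (≤-reflexive (m≡m%n+[m/n]*n n a))) (+-monoˡ-≤ ((n ℕ./ a) * a) (m%n<n n a))

large-board-bound : ∀ P q D n N → q ≤ P → 2 * n ≤ N → (P + q) * D * n ≤ P * D * N + P * n
large-board-bound P q D n N q≤P 2n≤N = begin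
  (P + q) * D * n   ≤⟨ *-monoˡ-≤ n (*-monoˡ-≤ D (+-monoʳ-≤ P q≤P)) ⟩
  (P + P) * D * n   ≡⟨ regroup P D n ⟩
  P * D * (2 * n)   ≤⟨ *-monoʳ-≤ (P * D) 2n≤N ⟩
  P * D * N         ≤⟨ m≤m+n (P * D * N) (P * n) ⟩
  P * D * N + P * n ∎
  where
    open ≤-Reasoning
    regroup : ∀ P D n → (P + P) * D * n ≡ P * D * (2 * n)
    regroup = solve-∀

scale-bound : ∀ P q D n N T → (P + q) * n ≤ P * N + T → D * T ≤ P * n → (P + q) * D * n ≤ P * D * N + P * n
scale-bound P q D n N T bound DT≤Pn = begin
  (P + q) * D * n      ≡⟨ regroup₁ P q D n ⟩
  D * ((P + q) * n)    ≤⟨ *-monoʳ-≤ D bound ⟩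
  D * (P * N + T)      ≡⟨ regroup₂ P D N T ⟩
  P * D * N + D * T    ≤⟨ +-monoʳ-≤ (P * D * N) DT≤Pn ⟩
  P * D * N + P * n    ∎
  where
    open ≤-Reasoning
    regroup₁ : ∀ P q D n → (P + q) * D * n ≡ D * ((P + q) * n)
    regroup₁ = solve-∀
    regroup₂ : ∀ P D N T → D * (P * N + T) ≡ P * D * N + D * T
    regroup₂ = solve-∀

threshold-cost : ∀ P D k C J′ A n → J′ * A ≤ n → D * (2 * k) ≤ A → D * (C * (2 * k) + 3 * k) ≤ n → 2 ≤ P →
                 D * ((J′ + C) * (2 * k) + 3 * k) ≤ P * n
threshold-cost P D k C J′ A n J′A≤n D2k≤A n₀≤n 2≤P = begin
  D * ((J′ + C) * (2 * k) + 3 * k)                  ≡⟨ regroup D k C J′ ⟩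
  J′ * (D * (2 * k)) + D * (C * (2 * k) + 3 * k)    ≤⟨ +-mono-≤ (≤-trans (*-monoʳ-≤ J′ D2k≤A) J′A≤n) n₀≤n ⟩
  n + n                                             ≡⟨ cong (n +_) (+-identityʳ n) ⟨
  2 * n                                             ≤⟨ *-monoˡ-≤ n 2≤P ⟩
  P * n                                             ∎
  where
    open ≤-Reasoning
    regroup : ∀ D k C J′ → D * ((J′ + C) * (2 * k) + 3 * k) ≡ J′ * (D * (2 * k)) + D * (C * (2 * k) + 3 * k)
    regroup = solve-∀

-- N ≥ (1 + q/(2p) − 1/D) n, with denominators cleared.
win⇒linear-bound : ∀ {p q} → 1 ≤ p → q ≤ 2 * p → ∀ D → ∃[ n₀ ] (∀ {n} → n₀ ≤ n → ∀ {N} → AliceWinsMB p q (Star n) N →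
                   (2 * p + q) * D * n ≤ 2 * p * D * N + 2 * p * n)
win⇒linear-bound {p} {q} 1≤p q≤2p D = n₀ , bound
  where
    k = 2 * p * q
    A = suc (2 * D * k)
    C = 2 * k * A
    n₀ = D * (C * (2 * k) + 3 * k)
    bound : ∀ {n} → n₀ ≤ n → ∀ {N} → AliceWinsMB p q (Star n) N → (2 * p + q) * D * n ≤ 2 * p * D * N + 2 * p * n
    bound {n} n₀≤n {N} win with 2 * n ≤? N
    ... | yes 2n≤N = large-board-bound (2 * p) q D n N q≤2p 2n≤N
    bound n₀≤n {zero} win | no _ = contradiction win ¬MBWin-K₀
    bound {n} n₀≤n {suc N′} win | no 2n≰N =
      scale-bound (2 * p) q D n (suc N′) _ (Strategy.win⇒bound p q n J N′ kN<2^J win (Strategy.Invariant-[] p q n J N′ kN<2^J))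
        (threshold-cost (2 * p) D k C J′ A n (m/n*n≤m n A) D2k≤A n₀≤n (*-monoʳ-≤ 2 1≤p))
      where
        J′ = n ℕ./ A
        J = J′ + C
        D2k≤A : D * (2 * k) ≤ A
        D2k≤A = ≤-trans (≤-reflexive (reorder D k)) (n≤1+n _)
          where
            reorder : ∀ D k → D * (2 * k) ≡ 2 * D * k
            reorder = solve-∀
        kN<2^J : k * suc N′ < 2 ^ J
        kN<2^J = begin-strict
          k * suc N′               ≤⟨ *-monoʳ-≤ k (<⇒≤ (≰⇒> 2n≰N)) ⟩
          k * (2 * n)              ≤⟨ *-monoʳ-≤ k (*-monoʳ-≤ 2 (<⇒≤ (n<[1+n/a]*a n A))) ⟩
          k * (2 * (suc J′ * A))   ≡⟨ reorder k A J′ ⟩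
          C * suc J′               <⟨ m*[1+j]<2^[j+m] C J′ ⟩
          2 ^ J                    ∎
          where
            open ≤-Reasoning
            reorder : ∀ k A J′ → k * (2 * ((1 + J′) * A)) ≡ 2 * k * A * (1 + J′)
            reorder = solve-∀

open import Data.Integer.Base using (+_)

-- The numerator of (1 + q/P − (1+a)/D) n − N over P D, in the form ℚᵘ arithmetic produces it, is non-positive once
-- (P + q) D n ≤ P D N + P n, as a is non-negative.
cross-multiplied : ∀ P q a D n N → (P + q) * D * n ≤ P * D * N + P * n →
  ((+ 1 ℤ.* + P ℤ.+ + q ℤ.* + 1) ℤ.* + D ℤ.+ ℤ.- (+ suc a) ℤ.* (+ 1 ℤ.* + P)) ℤ.* + n ℤ.* + 1
    ℤ.≤ + N ℤ.* + (1 * P * D * 1)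
cross-multiplied P q a D n N bound = begin
  ((+ 1 ℤ.* + P ℤ.+ + q ℤ.* + 1) ℤ.* + D ℤ.+ ℤ.- (+ 1 ℤ.+ + a) ℤ.* (+ 1 ℤ.* + P)) ℤ.* + n ℤ.* + 1
    ≡⟨ expand (+ P) (+ q) (+ D) (+ n) (+ a) ⟩
  (+ P ℤ.+ + q) ℤ.* + D ℤ.* + n ℤ.- + P ℤ.* + n ℤ.- + a ℤ.* + P ℤ.* + n
    ≡⟨ cong (λ x → (+ P ℤ.+ + q) ℤ.* + D ℤ.* + n ℤ.- + P ℤ.* + n ℤ.- x) (sym (pos-*³ a P n)) ⟩
  (+ P ℤ.+ + q) ℤ.* + D ℤ.* + n ℤ.- + P ℤ.* + n ℤ.- + (a * P * n)
    ≤⟨ ℤₚ.i-j≤i _ (+ (a * P * n)) ⟩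
  (+ P ℤ.+ + q) ℤ.* + D ℤ.* + n ℤ.- + P ℤ.* + n
    ≤⟨ ℤₚ.+-monoˡ-≤ (ℤ.- (+ P ℤ.* + n)) bound′ ⟩
  + P ℤ.* + D ℤ.* + N ℤ.+ + P ℤ.* + n ℤ.- + P ℤ.* + n
    ≡⟨ cancel (+ P) (+ D) (+ N) (+ n) ⟩
  + N ℤ.* (+ P ℤ.* + D)
    ≡⟨ cong (+ N ℤ.*_) (trans (sym (ℤₚ.pos-* P D)) (cong +_ (sym (units P D)))) ⟩
  + N ℤ.* + (1 * P * D * 1) ∎
  where
    open ℤₚ.≤-Reasoning
    expand : ∀ P q D n a → ((ℤ.1ℤ ℤ.* P ℤ.+ q ℤ.* ℤ.1ℤ) ℤ.* D ℤ.+ ℤ.- (ℤ.1ℤ ℤ.+ a) ℤ.* (ℤ.1ℤ ℤ.* P)) ℤ.* n ℤ.* ℤ.1ℤ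
                           ≡ (P ℤ.+ q) ℤ.* D ℤ.* n ℤ.- P ℤ.* n ℤ.- a ℤ.* P ℤ.* n
    expand = ℤ-Solver.solve-∀
    cancel : ∀ P D N n → P ℤ.* D ℤ.* N ℤ.+ P ℤ.* n ℤ.- P ℤ.* n ≡ N ℤ.* (P ℤ.* D)
    cancel = ℤ-Solver.solve-∀
    pos-*³ : ∀ a b c → + (a * b * c) ≡ + a ℤ.* + b ℤ.* + c
    pos-*³ a b c = trans (ℤₚ.pos-* (a * b) c) (cong (ℤ._* + c) (ℤₚ.pos-* a b))
    units : ∀ P D → 1 * P * D * 1 ≡ P * D
    units = solve-∀
    bound′ : (+ P ℤ.+ + q) ℤ.* + D ℤ.* + n ℤ.≤ + P ℤ.* + D ℤ.* + N ℤ.+ + P ℤ.* + n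
    bound′ = subst₂ ℤ._≤_
      (trans (ℤₚ.pos-* ((P + q) * D) n) (cong (ℤ._* + n) (trans (ℤₚ.pos-* (P + q) D) (cong (ℤ._* + D) (ℤₚ.pos-+ P q)))))
      (trans (ℤₚ.pos-+ (P * D * N) (P * n)) (cong₂ ℤ._+_ (pos-*³ P D N) (ℤₚ.pos-* P n)))
      (ℤ.+≤+ bound)

linear-bound⇒ℚ : ∀ p′ q a d n N .(coprime : Coprime (suc a) (suc d)) →
                 (2 * suc p′ + q) * suc d * n ≤ 2 * suc p′ * suc d * N + 2 * suc p′ * n →
                 (1ℚ ℚ.+ q/2p q (suc p′) ℚ.- mkℚ +[1+ a ] d coprime) ℚ.* (+ n ℚ./ 1) ℚ.≤ + N ℚ./ 1
linear-bound⇒ℚ p′ q a d n N coprime bound =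
  ℚₚ.toℚᵘ-cancel-≤ (ℚᵘₚ.≤-respˡ-≃ (ℚᵘₚ.≃-sym lhs) (ℚᵘₚ.≤-respʳ-≃ (ℚᵘₚ.≃-sym rhs) (*≤* (cross-multiplied P q a (suc d) n N bound))))
  where
    P = 2 * suc p′
    ε = mkℚ +[1+ a ] d coprime
    lhs : toℚᵘ ((1ℚ ℚ.+ q/2p q (suc p′) ℚ.- ε) ℚ.* (+ n ℚ./ 1)) ℚᵘ.≃
          (ℚᵘ.1ℚᵘ ℚᵘ.+ mkℚᵘ (+ q) (ℕ.pred P) ℚᵘ.+ ℚᵘ.- mkℚᵘ +[1+ a ] d) ℚᵘ.* mkℚᵘ (+ n) 0
    lhs = ℚᵘₚ.≃-trans (ℚₚ.toℚᵘ-homo-* (1ℚ ℚ.+ q/2p q (suc p′) ℚ.- ε) (+ n ℚ./ 1))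
            (ℚᵘₚ.*-cong (ℚᵘₚ.≃-trans (ℚₚ.toℚᵘ-homo-+ (1ℚ ℚ.+ q/2p q (suc p′)) (ℚ.- ε))
                           (ℚᵘₚ.+-cong (ℚᵘₚ.≃-trans (ℚₚ.toℚᵘ-homo-+ 1ℚ (q/2p q (suc p′)))
                                                    (ℚᵘₚ.+-cong (ℚᵘₚ.≃-refl {ℚᵘ.1ℚᵘ}) (ℚₚ.toℚᵘ-fromℚᵘ (mkℚᵘ (+ q) (ℕ.pred P)))))
                                       (ℚₚ.toℚᵘ-homo‿- ε)))
                        (ℚₚ.toℚᵘ-fromℚᵘ (mkℚᵘ (+ n) 0)))
    rhs : toℚᵘ (+ N ℚ./ 1) ℚᵘ.≃ mkℚᵘ (+ N) 0
    rhs = ℚₚ.toℚᵘ-fromℚᵘ (mkℚᵘ (+ N) 0)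

theorem2 : (p q : ℕ) → 1 ≤ q → q ≤ p →
    (ε : ℚ) → Positive ε →
    ∃[ n₀ ] ((n : ℕ) → n₀ ≤ n →
      ((N : ℕ) → AliceWinsAch p q (Star n) N → ∃[ N′ ] (N′ ≤ N × AliceWinsMB p q (Star n) N′))
      × ((N : ℕ) → AliceWinsMB p q (Star n) N → ((1ℚ ℚ.+ q/2p q p ℚ.- ε) ℚ.* (+ n ℚ./ 1)) ℚ.≤ (+ N ℚ./ 1)))
theorem2 zero     (suc q) _ ()
theorem2 (suc p′) q       _ q≤p (mkℚ +[1+ a ] d coprime) _
  with win⇒linear-bound (s≤s z≤n) (≤-trans q≤p (m≤m+n (suc p′) _)) (suc d)
... | n₀ , bound = n₀ , λ n n₀≤n →
  (λ N win → N , ≤-refl , AchWin⇒MBWin win) , (λ N win → linear-bound⇒ℚ p′ q a d n N coprime (bound n₀≤n win))
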